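{- Suppose $M$ is a model of GBC (not necessarily countable or transitive), $\mathbb P$ is a class forcing notion in $M$ that admits a forcing relation in $M$ for a first-order formula $\varphi$ which is standard in the meta-theory, in a forcing language with finitely many class names $\dot\Gamma_0,\ldots,\dot\Gamma_n$, and $G\subseteq\mathbb P$ is $M$-generic. Then for $\mathbb P$-names $\tau$ of $M$, $\langle M[G],\in_G,\Gamma_0,\ldots,\Gamma_n\rangle\models\varphi([\tau])$ if and only if there is $p\in G$ with $p\Vdash\varphi(\tau)$.
   Context: A class forcing notion is a separative class pre-order $\mathbb P$ with top $\mathbb 1$; a class name is a class of pairs $\langle\rho,p\rangle$ with $\rho$ a name, $p\in\mathbb P$. A forcing relation for $\varphi$ is a relation $\Vdash$ in $M$ defined on a subformula-closed collection of formulas containing all atomic formulas and all instances of $\varphi$, satisfying: $p\Vdash\sigma\in\tau$ iff densely many $q\le p$ have $\langle\rho,r\rangle\in\tau$ with $q\le r$, $q\Vdash\sigma=\rho$; $p\Vdash\sigma=\tau$ iff $p\Vdash\sigma\subseteq\tau$ and $p\Vdash\tau\subseteq\sigma$, where $p\Vdash\sigma\subseteq\tau$ iff whenever $\langle\rho,r\rangle\in\sigma$ and $q'\le p,r$ there is $q\le q'$ with $q\Vdash\rho\in\tau$; $p\Vdash\sigma\in\dot\Gamma$ iff densely many $q\le p$ have $\langle\tau,r\rangle\in\dot\Gamma$ with $q\le r$, $q\Vdash\sigma=\tau$; $p\Vdash\varphi\wedge\psi$ iff both; $p\Vdash\neg\varphi$ iff no $q\le p$ forces $\varphi$; $p\Vdash\forall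 x\,\varphi(x)$ iff $p\Vdash\varphi(\tau)$ for all names $\tau$. A filter $G\subseteq\mathbb P$ is $M$-generic if it meets every dense subclass of $\mathbb P$ in $M$. On names of $M$ define $\sigma=_G\tau$ iff $\exists p\in G\ p\Vdash\sigma=\tau$ and $\sigma\in_G\tau$ iff $\exists p\in G\ p\Vdash\sigma\in\tau$; $M[G]$ is the set of $=_G$-classes $[\sigma]$ with the induced relation $\in_G$, and for each class name $\dot\Gamma_i$, $\Gamma_i([\sigma])$ iff $\exists p\in G\ p\Vdash\sigma\in\dot\Gamma_i$. -}

module Defs where

open import Data.Nat using (ℕ; zero; suc)
open import Data.Fin using (Fin)
open import Data.Vec.Functional using (Vector; _∷_; head; tail)
open import Data.Product using (Σ; _×_; _,_; proj₁)
open import Data.Sum using (_⊎_)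
open import Relation.Nullary using (¬_)
open import Relation.Binary.PropositionalEquality using (_≡_)
open import Function.Bundles using (_⇔_)

-- Two-sorted language of GBC: formulas with set variables (de Bruijn,
-- Fin k) and class parameters (elements of the class sort C).
-- Only set quantifiers: this is the language of predicative comprehension.

data CForm (C : Set) (k : ℕ) : Set where
  _∈ᵥ_  : Fin k → Fin k → CForm C k
  _≐ᵥ_  : Fin k → Fin k → CForm C k
  _∈ᶜᵥ_ : Fin k → C → CForm C k
  ¬ᵥ_   : CForm C k → CForm C k
  _∧ᵥ_  : CForm C k → CForm C k → CForm C k
  ∀ᵥ    : CForm C (suc k) → CForm C k

CSat : {S C : Set} → (S → S → Set) → (S → C → Set) →
       {k : ℕ} → CForm C k → Vector S k → Set
CSat _∈_ _∈ᶜ_ (i ∈ᵥ j)  ρ = ρ i ∈ ρ j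
CSat _∈_ _∈ᶜ_ (i ≐ᵥ j)  ρ = ρ i ≡ ρ j
CSat _∈_ _∈ᶜ_ (i ∈ᶜᵥ X) ρ = ρ i ∈ᶜ X
CSat _∈_ _∈ᶜ_ (¬ᵥ ψ)    ρ = ¬ CSat _∈_ _∈ᶜ_ ψ ρ
CSat _∈_ _∈ᶜ_ (ψ ∧ᵥ χ)  ρ = CSat _∈_ _∈ᶜ_ ψ ρ × CSat _∈_ _∈ᶜ_ χ ρ
CSat _∈_ _∈ᶜ_ (∀ᵥ ψ)    ρ = (x : _) → CSat _∈_ _∈ᶜ_ ψ (x ∷ ρ)

module Basic {S C : Set} (_∈_ : S → S → Set) (_∈ᶜ_ : S → C → Set) where

  IsUPair : S → S → S → Set
  IsUPair u a b = (w : S) → (w ∈ u) ⇔ (w ≡ a ⊎ w ≡ b)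

  IsPair : S → S → S → Set
  IsPair z x y = (u : S) → (u ∈ z) ⇔ (IsUPair u x x ⊎ IsUPair u x y)

  PairElem : S → S → S → Set
  PairElem x y s = Σ S λ z → IsPair z x y × z ∈ s

  PairIn : S → S → C → Set
  PairIn x y X = Σ S λ z → IsPair z x y × z ∈ᶜ X

  IsEmpty : S → Set
  IsEmpty z = (w : S) → ¬ (w ∈ z)

  IsTuple : {m : ℕ} → S → Vector S m → Set
  IsTuple {zero}  z xs = IsEmpty z
  IsTuple {suc m} z xs = Σ S λ w → IsPair z (head xs) w × IsTuple w (tail xs)

  TupleIn : {m : ℕ} → Vector S m → C → Set
  TupleIn xs X = Σ S λ z → IsTuple z xs × z ∈ᶜ X

  Functional : C → Set
  Functional F = (v w w' : S) → PairIn v w F → PairIn v w' F → w ≡ w'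

-- Models of GBC (two-sorted: sets and classes; not necessarily
-- countable or well-founded; equality of the model is ≡).

record IsGBC {S C : Set} (_∈_ : S → S → Set) (_∈ᶜ_ : S → C → Set) : Set where
  open Basic _∈_ _∈ᶜ_
  field
    extensionality      : (x y : S) → ((z : S) → (z ∈ x) ⇔ (z ∈ y)) → x ≡ y
    class-extensionality : (X Y : C) → ((z : S) → (z ∈ᶜ X) ⇔ (z ∈ᶜ Y)) → X ≡ Y
    pairing   : (x y : S) → Σ S λ z → IsUPair z x y
    union     : (x : S) → Σ S λ u → (w : S) → (w ∈ u) ⇔ (Σ S λ y → y ∈ x × w ∈ y)
    powerset  : (x : S) → Σ S λ p → (w : S) → (w ∈ p) ⇔ ((v : S) → v ∈ w → v ∈ x)
    infinity  : Σ S λ ω → (Σ S λ e → e ∈ ω × IsEmpty e) ×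
                ((y : S) → y ∈ ω → Σ S λ s → s ∈ ω × ((w : S) → (w ∈ s) ⇔ (w ∈ y ⊎ w ≡ y)))
    foundation : (x : S) → (Σ S λ y → y ∈ x) → Σ S λ y → y ∈ x × ¬ (Σ S λ z → z ∈ y × z ∈ x)
    separation : (x : S) (X : C) → Σ S λ y → (w : S) → (w ∈ y) ⇔ (w ∈ x × w ∈ᶜ X)
    replacement : (F : C) → Functional F → (x : S) →
                  Σ S λ y → (w : S) → (w ∈ y) ⇔ (Σ S λ v → v ∈ x × PairIn v w F)
    comprehension : {k : ℕ} (ψ : CForm C (suc k)) (a : Vector S k) →
                    Σ C λ X → (x : S) → (x ∈ᶜ X) ⇔ CSat _∈_ _∈ᶜ_ ψ (x ∷ a)
    global-choice : Σ C λ F → Functional F ×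
                    ((x : S) → (Σ S λ y → y ∈ x) → Σ S λ y → y ∈ x × PairIn x y F)

record GBCModel : Set₁ where
  field
    S   : Set
    C   : Set
    _∈_  : S → S → Set
    _∈ᶜ_ : S → C → Set
    isGBC : IsGBC _∈_ _∈ᶜ_
  open Basic _∈_ _∈ᶜ_ public

record ClassForcingNotion (M : GBCModel) : Set where
  open GBCModel M
  field
    P  : C
    Le : C
    𝟙  : S
  _≤_ : S → S → Set
  p ≤ q = PairIn p q Le
  field
    Le⊆P×P   : (z : S) → z ∈ᶜ Le → Σ S λ p → Σ S λ q → IsPair z p q × p ∈ᶜ P × q ∈ᶜ P
    ≤-refl   : (p : S) → p ∈ᶜ P → p ≤ p
    ≤-trans  : (p q r : S) → p ∈ᶜ P → q ∈ᶜ P → r ∈ᶜ P → p ≤ q → q ≤ r → p ≤ r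
    𝟙∈P      : 𝟙 ∈ᶜ P
    𝟙-top    : (p : S) → p ∈ᶜ P → p ≤ 𝟙
    separative : (p q : S) → p ∈ᶜ P → q ∈ᶜ P → ¬ (p ≤ q) →
                 Σ S λ r → r ∈ᶜ P × r ≤ p ×
                   ¬ (Σ S λ s → s ∈ᶜ P × s ≤ r × s ≤ q)

module Names (M : GBCModel) (ℙ : ClassForcingNotion M) where
  open GBCModel M
  open ClassForcingNotion ℙ

  -- σ is a ℙ-name (of M): σ lies in some set N all of whose elements are
  -- sets of pairs ⟨ρ , p⟩ with ρ ∈ N and p ∈ ℙ.  (Equivalent in GBC to the
  -- ∈-recursive definition, using foundation.)
  IsName : S → Set
  IsName σ = Σ S λ N → σ ∈ N ×
    ((x : S) → x ∈ N → (y : S) → y ∈ x →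
       Σ S λ ρ → Σ S λ p → IsPair y ρ p × ρ ∈ N × p ∈ᶜ P)

  AllNames : {m : ℕ} → Vector S m → Set
  AllNames τ = (i : Fin _) → IsName (τ i)

  IsClassName : C → Set
  IsClassName Γ = (z : S) → z ∈ᶜ Γ → Σ S λ ρ → Σ S λ p → IsPair z ρ p × IsName ρ × p ∈ᶜ P

  DenselyBelow : S → (S → Set) → Set
  DenselyBelow p Q = (r : S) → r ∈ᶜ P → r ≤ p → Σ S λ q → q ∈ᶜ P × q ≤ r × Q q

  Definable : (m : ℕ) → (S → Vector S m → Set) → Set
  Definable m R = Σ C λ X → (p : S) (τ : Vector S m) → p ∈ᶜ P → AllNames τ →
                  R p τ ⇔ TupleIn (p ∷ τ) X

  IsFilter : (S → Set) → Set
  IsFilter G = ((p : S) → G p → p ∈ᶜ P) × G 𝟙 ×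
               ((p q : S) → G p → q ∈ᶜ P → p ≤ q → G q) ×
               ((p q : S) → G p → G q → Σ S λ r → G r × r ≤ p × r ≤ q)

  IsDense : C → Set
  IsDense D = ((p : S) → p ∈ᶜ D → p ∈ᶜ P) × ((p : S) → p ∈ᶜ P → Σ S λ q → q ∈ᶜ D × q ≤ p)

  IsGeneric : (S → Set) → Set
  IsGeneric G = IsFilter G × ((D : C) → IsDense D → Σ S λ p → G p × p ∈ᶜ D)

ClassName : (M : GBCModel) → ClassForcingNotion M → Set
ClassName M ℙ = Σ (GBCModel.C M) (Names.IsClassName M ℙ)

-- The (meta-level, standard) forcing language: ∈, =, and class names
-- Γ̇₀ … Γ̇_{r-1}; connectives ¬, ∧, ∀ (others are abbreviations).

data Formula (r k : ℕ) : Set where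
  _∈ᶠ_  : Fin k → Fin k → Formula r k
  _≐ᶠ_  : Fin k → Fin k → Formula r k
  _∈Γ_  : Fin k → Fin r → Formula r k
  ¬ᶠ_   : Formula r k → Formula r k
  _∧ᶠ_  : Formula r k → Formula r k → Formula r k
  ∀ᶠ    : Formula r (suc k) → Formula r k

data _≼_ {r m : ℕ} (ψ : Formula r m) : {k : ℕ} → Formula r k → Set where
  ≼-refl : ψ ≼ ψ
  ≼-¬    : {k : ℕ} {χ : Formula r k} → ψ ≼ χ → ψ ≼ (¬ᶠ χ)
  ≼-∧ˡ   : {k : ℕ} {χ χ' : Formula r k} → ψ ≼ χ → ψ ≼ (χ ∧ᶠ χ')
  ≼-∧ʳ   : {k : ℕ} {χ χ' : Formula r k} → ψ ≼ χ' → ψ ≼ (χ ∧ᶠ χ')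
  ≼-∀    : {k : ℕ} {χ : Formula r (suc k)} → ψ ≼ χ → ψ ≼ ∀ᶠ χ

module ForcingDefs (M : GBCModel) (ℙ : ClassForcingNotion M)
                   {r : ℕ} (Γ : Fin r → ClassName M ℙ) where
  open GBCModel M
  open ClassForcingNotion ℙ
  open Names M ℙ

  module Clauses (⊩∈ ⊩≐ : S → S → S → Set) (⊩Γ : Fin r → S → S → Set)
                 (⊩ : {m : ℕ} → Formula r m → S → Vector S m → Set) where

    ClauseIn : S → S → S → Set
    ClauseIn p σ τ = DenselyBelow p λ q →
      Σ S λ ρ → Σ S λ s → PairElem ρ s τ × q ≤ s × ⊩≐ q σ ρ

    ForcesSub : S → S → S → Set
    ForcesSub p σ τ = (ρ s : S) → PairElem ρ s σ → (q' : S) → q' ∈ᶜ P → q' ≤ p → q' ≤ s →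
      Σ S λ q → q ∈ᶜ P × q ≤ q' × ⊩∈ q ρ τ

    ClauseEq : S → S → S → Set
    ClauseEq p σ τ = ForcesSub p σ τ × ForcesSub p τ σ

    ClauseΓ : Fin r → S → S → Set
    ClauseΓ i p σ = DenselyBelow p λ q →
      Σ S λ τ → Σ S λ s → PairIn τ s (proj₁ (Γ i)) × q ≤ s × ⊩≐ q σ τ

    Clause : {m : ℕ} → Formula r m → S → Vector S m → Set
    Clause (i ∈ᶠ j) p τ = ⊩∈ p (τ i) (τ j)
    Clause (i ≐ᶠ j) p τ = ⊩≐ p (τ i) (τ j)
    Clause (i ∈Γ c) p τ = ⊩Γ c p (τ i)
    Clause (¬ᶠ ψ)   p τ = ¬ (Σ S λ q → q ∈ᶜ P × q ≤ p × ⊩ ψ q τ)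
    Clause (ψ ∧ᶠ χ) p τ = ⊩ ψ p τ × ⊩ χ p τ
    Clause (∀ᶠ ψ)   p τ = (σ : S) → IsName σ → ⊩ ψ p (σ ∷ τ)

  record ForcingRelation {k : ℕ} (φ : Formula r k) : Set₁ where
    field
      ⊩∈ : S → S → S → Set
      ⊩≐ : S → S → S → Set
      ⊩Γ : Fin r → S → S → Set
      ⊩  : {m : ℕ} → Formula r m → S → Vector S m → Set
    open Clauses ⊩∈ ⊩≐ ⊩Γ ⊩
    field
      def-∈ : Definable 2 λ p τ → ⊩∈ p (τ Fin.zero) (τ (Fin.suc Fin.zero))
      def-≐ : Definable 2 λ p τ → ⊩≐ p (τ Fin.zero) (τ (Fin.suc Fin.zero))
      def-Γ : (i : Fin r) → Definable 1 λ p τ → ⊩Γ i p (τ Fin.zero)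
      def-sub : {m : ℕ} {ψ : Formula r m} → ψ ≼ φ → Definable m (⊩ ψ)
      clause-∈ : (p σ τ : S) → p ∈ᶜ P → IsName σ → IsName τ → ⊩∈ p σ τ ⇔ ClauseIn p σ τ
      clause-≐ : (p σ τ : S) → p ∈ᶜ P → IsName σ → IsName τ → ⊩≐ p σ τ ⇔ ClauseEq p σ τ
      clause-Γ : (i : Fin r) (p σ : S) → p ∈ᶜ P → IsName σ → ⊩Γ i p σ ⇔ ClauseΓ i p σ
      clause-sub : {m : ℕ} {ψ : Formula r m} → ψ ≼ φ →
                   (p : S) (τ : Vector S m) → p ∈ᶜ P → AllNames τ → ⊩ ψ p τ ⇔ Clause ψ p τ

  -- Satisfaction in ⟨M[G], ∈_G, Γ₀, …⟩, computed on representatives: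
  -- M[G] is the quotient of the names by =_G; quantifiers range over
  -- names, = is interpreted by =_G, ∈ by ∈_G, Γᵢ as in the paper.
  module Extension {k : ℕ} {φ : Formula r k} (F : ForcingRelation φ) (G : S → Set) where
    open ForcingRelation F

    Sat : {m : ℕ} → Formula r m → Vector S m → Set
    Sat (i ∈ᶠ j) τ = Σ S λ p → G p × ⊩∈ p (τ i) (τ j)
    Sat (i ≐ᶠ j) τ = Σ S λ p → G p × ⊩≐ p (τ i) (τ j)
    Sat (i ∈Γ c) τ = Σ S λ p → G p × ⊩Γ c p (τ i)
    Sat (¬ᶠ ψ)   τ = ¬ Sat ψ τ
    Sat (ψ ∧ᶠ χ) τ = Sat ψ τ × Sat χ τ
    Sat (∀ᶠ ψ)   τ = (σ : S) → IsName σ → Sat ψ (σ ∷ τ)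

-- Forcing is preserved downwards (⊩-mono) and holds at p
-- as soon as it holds densely below p (⊩-dense). The atomic cases hold by the definition of
-- M[G], and ∧ uses a common extension in G of two forcing conditions. For ¬ψ and ∀ψ the
-- conditions that either force the formula or below which nothing forces (an instance of) ψ are
-- dense; as the forcing relation for subformulas of φ is a class of M, this dense collection is
-- definable in M from the names, so G meets it, and a condition of G below which nothing forces
-- ψ(σ) is incompatible with every condition of G forcing ψ(σ).

module Submission where

open import Defs
open import Data.Nat using (ℕ; suc; _+_)
open import Data.Fin using (Fin; zero; suc; lift)
open import Data.Vec.Functional using (Vector; _∷_)
open import Data.Product using (Σ; _×_; _,_; proj₁; proj₂; uncurry)
open import Data.Product.Function.NonDependent.Propositional using (_×-⇔_)
open import Data.Sum using (_⊎_; inj₁; inj₂; [_,_]; [_,_]′)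
open import Data.Sum.Function.Propositional using (_⊎-⇔_)
open import Data.Empty using (⊥-elim)
open import Function using (_∘_; id)
open import Function.Bundles using (_⇔_; mk⇔; Equivalence)
open import Function.Construct.Identity using (⇔-id)
open import Function.Construct.Symmetry using (⇔-sym)
open import Function.Construct.Composition using (_⇔-∘_)
open import Function.Related.TypeIsomorphisms using (¬-cong-⇔)
open import Relation.Nullary using (¬_; yes; no)
open import Relation.Binary.PropositionalEquality using (_≡_; refl; sym; trans; subst; _≗_)
open import Axiom.ExcludedMiddle using (ExcludedMiddle)
open import Axiom.DoubleNegationElimination using (DoubleNegationElimination; em⇒dne)
open import Level using (0ℓ)

open Equivalence

≼-trans : {r m k l : ℕ} {ψ : Formula r m} {χ : Formula r k} {θ : Formula r l} →
          ψ ≼ χ → χ ≼ θ → ψ ≼ θ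
≼-trans s ≼-refl   = s
≼-trans s (≼-¬ t)  = ≼-¬ (≼-trans s t)
≼-trans s (≼-∧ˡ t) = ≼-∧ˡ (≼-trans s t)
≼-trans s (≼-∧ʳ t) = ≼-∧ʳ (≼-trans s t)
≼-trans s (≼-∀ t)  = ≼-∀ (≼-trans s t)

module _ {r m k : ℕ} {φ : Formula r k} where

  ≼-¬⁻ : {ψ : Formula r m} → (¬ᶠ ψ) ≼ φ → ψ ≼ φ
  ≼-¬⁻ = ≼-trans (≼-¬ ≼-refl)

  ≼-∧ˡ⁻ : {ψ χ : Formula r m} → (ψ ∧ᶠ χ) ≼ φ → ψ ≼ φ
  ≼-∧ˡ⁻ = ≼-trans (≼-∧ˡ ≼-refl)

  ≼-∧ʳ⁻ : {ψ χ : Formula r m} → (ψ ∧ᶠ χ) ≼ φ → χ ≼ φ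
  ≼-∧ʳ⁻ = ≼-trans (≼-∧ʳ ≼-refl)

  ≼-∀⁻ : {ψ : Formula r (suc m)} → ∀ᶠ ψ ≼ φ → ψ ≼ φ
  ≼-∀⁻ = ≼-trans (≼-∀ ≼-refl)

module Renaming {S C : Set} (_∈_ : S → S → Set) (_∈ᶜ_ : S → C → Set) where

  rename : {k l : ℕ} → (Fin k → Fin l) → CForm C k → CForm C l
  rename f (i ∈ᵥ j)  = f i ∈ᵥ f j
  rename f (i ≐ᵥ j)  = f i ≐ᵥ f j
  rename f (i ∈ᶜᵥ X) = f i ∈ᶜᵥ X
  rename f (¬ᵥ ψ)    = ¬ᵥ rename f ψ
  rename f (ψ ∧ᵥ χ)  = rename f ψ ∧ᵥ rename f χ
  rename f (∀ᵥ ψ)    = ∀ᵥ (rename (lift 1 f) ψ)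

  private
    subst-⇔ : (R : S → Set) {a a' : S} → a ≡ a' → R a ⇔ R a'
    subst-⇔ R refl = ⇔-id _

    subst₂-⇔ : (R : S → S → Set) {a a' b b' : S} → a ≡ a' → b ≡ b' → R a b ⇔ R a' b'
    subst₂-⇔ R refl refl = ⇔-id _

  CSat-rename : {k l : ℕ} (f : Fin k → Fin l) (ψ : CForm C k) {ρ : Vector S l} {ρ' : Vector S k} →
                ρ ∘ f ≗ ρ' → CSat _∈_ _∈ᶜ_ (rename f ψ) ρ ⇔ CSat _∈_ _∈ᶜ_ ψ ρ'
  CSat-rename f (i ∈ᵥ j)  eq = subst₂-⇔ _∈_ (eq i) (eq j)
  CSat-rename f (i ≐ᵥ j)  eq = subst₂-⇔ _≡_ (eq i) (eq j)
  CSat-rename f (i ∈ᶜᵥ X) eq = subst-⇔ (_∈ᶜ X) (eq i)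
  CSat-rename f (¬ᵥ ψ)    eq = ¬-cong-⇔ (CSat-rename f ψ eq)
  CSat-rename f (ψ ∧ᵥ χ)  eq = CSat-rename f ψ eq ×-⇔ CSat-rename f χ eq
  CSat-rename f (∀ᵥ ψ) {ρ} {ρ'} eq = mk⇔ (λ h x → to (ih x) (h x)) (λ h x → from (ih x) (h x))
    where
    ih : (x : S) → CSat _∈_ _∈ᶜ_ (rename (lift 1 f) ψ) (x ∷ ρ) ⇔ CSat _∈_ _∈ᶜ_ ψ (x ∷ ρ')
    ih x = CSat-rename (lift 1 f) ψ λ { zero → refl ; (suc i) → eq i }

module Expressibility (em : ExcludedMiddle 0ℓ) (M : GBCModel) where
  open GBCModel M

  private
    dne : DoubleNegationElimination 0ℓ
    dne = em⇒dne em

    variable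
      k : ℕ
      Q R : Vector S k → Set

  Expressible : (k : ℕ) → (Vector S k → Set) → Set
  Expressible k Q = Σ (CForm C k) λ ψ → (ρ : Vector S k) → CSat _∈_ _∈ᶜ_ ψ ρ ⇔ Q ρ

  CSat-expressible : (ψ : CForm C k) → Expressible k (CSat _∈_ _∈ᶜ_ ψ)
  CSat-expressible ψ = ψ , λ _ → ⇔-id _

  expr-resp : Expressible k Q → ((ρ : Vector S k) → Q ρ ⇔ R ρ) → Expressible k R
  expr-resp (ψ , e) g = ψ , λ ρ → g ρ ⇔-∘ e ρ

  expr-∈ : (i j : Fin k) → Expressible k (λ ρ → ρ i ∈ ρ j)
  expr-∈ i j = CSat-expressible (i ∈ᵥ j)

  expr-≡ : (i j : Fin k) → Expressible k (λ ρ → ρ i ≡ ρ j)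
  expr-≡ i j = CSat-expressible (i ≐ᵥ j)

  expr-∈ᶜ : (i : Fin k) (X : C) → Expressible k (λ ρ → ρ i ∈ᶜ X)
  expr-∈ᶜ i X = CSat-expressible (i ∈ᶜᵥ X)

  expr-¬ : Expressible k Q → Expressible k (λ ρ → ¬ Q ρ)
  expr-¬ (ψ , e) = ¬ᵥ ψ , λ ρ → ¬-cong-⇔ (e ρ)

  expr-× : Expressible k Q → Expressible k R → Expressible k (λ ρ → Q ρ × R ρ)
  expr-× (ψ , e) (χ , f) = ψ ∧ᵥ χ , λ ρ → e ρ ×-⇔ f ρ

  expr-Π : {Q : Vector S (suc k) → Set} → Expressible (suc k) Q →
           Expressible k (λ ρ → (x : S) → Q (x ∷ ρ))
  expr-Π (ψ , e) = ∀ᵥ ψ , λ ρ → mk⇔ (λ h x → to (e _) (h x)) (λ h x → from (e _) (h x))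

  expr-Σ : {Q : Vector S (suc k) → Set} → Expressible (suc k) Q →
           Expressible k (λ ρ → Σ S λ x → Q (x ∷ ρ))
  expr-Σ e = expr-resp (expr-¬ (expr-Π (expr-¬ e))) λ ρ → mk⇔
    (λ ¬∀¬ → dne λ ∄ → ¬∀¬ λ x q → ∄ (x , q))
    (λ (x , q) ∀¬ → ∀¬ x q)

  expr-⊎ : Expressible k Q → Expressible k R → Expressible k (λ ρ → Q ρ ⊎ R ρ)
  expr-⊎ e f = expr-resp (expr-¬ (expr-× (expr-¬ e) (expr-¬ f))) λ ρ → mk⇔
    (λ ¬¬⊎ → dne λ ¬⊎ → ¬¬⊎ (¬⊎ ∘ inj₁ , ¬⊎ ∘ inj₂))
    (λ q⊎r (¬q , ¬r) → [ ¬q , ¬r ] q⊎r)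

  expr-→ : Expressible k Q → Expressible k R → Expressible k (λ ρ → Q ρ → R ρ)
  expr-→ e f = expr-resp (expr-¬ (expr-× e (expr-¬ f))) λ ρ → mk⇔
    (λ ¬q×¬r q → dne λ ¬r → ¬q×¬r (q , ¬r))
    (λ q→r (q , ¬r) → ¬r (q→r q))

  expr-⇔ : Expressible k Q → Expressible k R → Expressible k (λ ρ → Q ρ ⇔ R ρ)
  expr-⇔ e f = expr-resp (expr-× (expr-→ e f) (expr-→ f e)) λ ρ →
    mk⇔ (uncurry mk⇔) (λ q⇔r → to q⇔r , from q⇔r)

  expr-IsUPair : (u a b : Fin k) → Expressible k (λ ρ → IsUPair (ρ u) (ρ a) (ρ b))
  expr-IsUPair u a b =
    expr-Π (expr-⇔ (expr-∈ zero (suc u)) (expr-⊎ (expr-≡ zero (suc a)) (expr-≡ zero (suc b))))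

  expr-IsPair : (z x y : Fin k) → Expressible k (λ ρ → IsPair (ρ z) (ρ x) (ρ y))
  expr-IsPair z x y =
    expr-Π (expr-⇔ (expr-∈ zero (suc z))
                   (expr-⊎ (expr-IsUPair zero (suc x) (suc x)) (expr-IsUPair zero (suc x) (suc y))))

  expr-PairIn : (x y : Fin k) (X : C) → Expressible k (λ ρ → PairIn (ρ x) (ρ y) X)
  expr-PairIn x y X = expr-Σ (expr-× (expr-IsPair zero (suc x) (suc y)) (expr-∈ᶜ zero X))

  expr-IsTuple : {m : ℕ} (z : Fin k) (xs : Vector (Fin k) m) →
                 Expressible k (λ ρ → IsTuple (ρ z) (ρ ∘ xs))
  expr-IsTuple {m = ℕ.zero} z xs = expr-Π (expr-¬ (expr-∈ zero (suc z)))
  expr-IsTuple {m = suc m}  z xs =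
    expr-Σ (expr-× (expr-IsPair (suc z) (suc (xs zero)) zero) (expr-IsTuple zero (suc ∘ xs ∘ suc)))

  expr-TupleIn : (X : C) → Expressible k (λ ρ → TupleIn ρ X)
  expr-TupleIn X = expr-Σ (expr-× (expr-IsTuple zero suc) (expr-∈ᶜ zero X))

module Pairs (M : GBCModel) where
  open GBCModel M
  open IsGBC isGBC using (pairing)

  private
    variable
      u w x y z : S

  IsPair-∈∈ : IsPair z x y → u ∈ z → w ∈ u → w ≡ x ⊎ w ≡ y
  IsPair-∈∈ pz u∈z w∈u =
    [ (λ u-xx → [ inj₁ , inj₁ ] (to (u-xx _) w∈u)) , (λ u-xy → to (u-xy _) w∈u) ] (to (pz _) u∈z)

  IsPair-head-∈ : IsPair z x y → u ∈ z → x ∈ u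
  IsPair-head-∈ pz u∈z =
    [ (λ u-xx → from (u-xx _) (inj₁ refl)) , (λ u-xy → from (u-xy _) (inj₁ refl)) ] (to (pz _) u∈z)

  IsPair-injective : {x' y' : S} → IsPair z x y → IsPair z x' y' → x ≡ x' × y ≡ y'
  IsPair-injective {x = x} {y} {x'} {y'} pz pz' = x≡x' , y≡y'
    where
    x≡x' : x ≡ x'
    x≡x' = let (A , A-xx) = pairing x x in
      sym ([ id , id ] (to (A-xx x') (IsPair-head-∈ pz' (from (pz A) (inj₁ A-xx)))))

    y-in-other : {z x y x' y' : S} → IsPair z x y → IsPair z x' y' → y ≡ x' ⊎ y ≡ y'
    y-in-other {x = x} {y} pz pz' = let (B , B-xy) = pairing x y in
      IsPair-∈∈ pz' (from (pz B) (inj₂ B-xy)) (from (B-xy y) (inj₂ refl))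

    -- Each second component lies in the other pair; if neither is the other's, y = x' = x = y'.
    y≡y' : y ≡ y'
    y≡y' with y-in-other pz pz' | y-in-other pz' pz
    ... | inj₂ y≡y'     | _            = y≡y'
    ... | inj₁ _        | inj₂ y'≡y    = sym y'≡y
    ... | inj₁ y≡x'     | inj₁ y'≡x    = trans y≡x' (trans (sym x≡x') (sym y'≡x))

module NameVectors (M : GBCModel) (ℙ : ClassForcingNotion M) where
  open GBCModel M
  open Names M ℙ

  AllNames-∷ : {m : ℕ} {σ : S} {τ : Vector S m} → IsName σ → AllNames τ → AllNames (σ ∷ τ)
  AllNames-∷ nσ nτ zero    = nσ
  AllNames-∷ nσ nτ (suc i) = nτ i

module Order (M : GBCModel) (ℙ : ClassForcingNotion M) where
  open GBCModel M
  open ClassForcingNotion ℙ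
  open Names M ℙ
  open Pairs M

  private
    variable
      p q r : S
      Q Q' : S → Set

  ≤⇒∈P : p ≤ q → q ∈ᶜ P
  ≤⇒∈P (z , z-pq , z∈Le) =
    let (_ , _ , z-ab , _ , bP) = Le⊆P×P z z∈Le in
    subst (_∈ᶜ P) (sym (proj₂ (IsPair-injective z-pq z-ab))) bP

  ≤-trans′ : p ∈ᶜ P → p ≤ q → q ≤ r → p ≤ r
  ≤-trans′ {p} {q} {r} pP p≤q q≤r = ≤-trans p q r pP (≤⇒∈P p≤q) (≤⇒∈P q≤r) p≤q q≤r

  NoneBelow : S → (S → Set) → Set
  NoneBelow p Q = ¬ (Σ S λ q → q ∈ᶜ P × q ≤ p × Q q)

  DenselyBelow-map : ({q : S} → q ∈ᶜ P → Q q → Q' q) → DenselyBelow p Q → DenselyBelow p Q'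
  DenselyBelow-map f h r rP r≤p =
    let (q , qP , q≤r , Qq) = h r rP r≤p in q , qP , q≤r , f qP Qq

  DenselyBelow-mono : q ≤ p → DenselyBelow p Q → DenselyBelow q Q
  DenselyBelow-mono q≤p h r rP r≤q = h r rP (≤-trans′ rP r≤q q≤p)

  DenselyBelow-idem : DenselyBelow p (λ q → DenselyBelow q Q) → DenselyBelow p Q
  DenselyBelow-idem h r rP r≤p =
    let (q , qP , q≤r , dense) = h r rP r≤p
        (q' , q'P , q'≤q , Qq') = dense q qP (≤-refl q qP)
    in q' , q'P , ≤-trans′ q'P q'≤q q≤r , Qq'

  DenselyBelow-decided : ExcludedMiddle 0ℓ → DenselyBelow p (λ q → Q q ⊎ NoneBelow q Q)
  DenselyBelow-decided {Q = Q} em r rP r≤p with em {Σ S λ q → q ∈ᶜ P × q ≤ r × Q q}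
  ... | yes (q , qP , q≤r , Qq) = q , qP , q≤r , inj₁ Qq
  ... | no none                 = r , rP , ≤-refl r rP , inj₂ none

  ¬DenselyBelow⇒NoneBelow : DoubleNegationElimination 0ℓ → ¬ DenselyBelow p Q →
                            Σ S λ r → r ∈ᶜ P × r ≤ p × NoneBelow r Q
  ¬DenselyBelow⇒NoneBelow dne ¬dense = dne λ ∄ → ¬dense λ r rP r≤p →
    dne λ ¬Q → ∄ (r , rP , r≤p , λ (q , qP , q≤r , Qq) → ¬Q (q , qP , q≤r , Qq))

module FormulaDefinability (em : ExcludedMiddle 0ℓ) (M : GBCModel) (ℙ : ClassForcingNotion M) where
  open GBCModel M
  open ClassForcingNotion ℙ
  open Names M ℙ
  open Order M ℙ
  open NameVectors M ℙ
  open Expressibility em M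
  open Renaming _∈_ _∈ᶜ_

  private
    variable
      m : ℕ

  expr-IsName : {k : ℕ} (σ : Fin k) → Expressible k (λ ρ → IsName (ρ σ))
  expr-IsName σ =
    expr-Σ (expr-× (expr-∈ (suc σ) zero)
      (expr-Π (expr-→ (expr-∈ zero (suc zero)) (expr-Π (expr-→ (expr-∈ zero (suc zero))
        (expr-Σ (expr-Σ (expr-× (expr-IsPair x₂ x₁ x₀)
          (expr-× (expr-∈ x₁ x₄) (expr-∈ᶜ x₀ P))))))))))
    where
    -- x₀ … x₄ are the variables p, ρ, y, x, N of IsName, innermost first
    x₀ x₁ x₂ x₄ : {k : ℕ} → Fin (5 + k)
    x₀ = zero
    x₁ = suc zero
    x₂ = suc (suc zero)
    x₄ = suc (suc (suc (suc zero)))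

  -- A formula instead of a class of tuples (as in Definable): formulas are closed under the
  -- logical operations, and comprehension with the names as parameters turns one into a class
  -- of conditions.
  FormulaDefinable : (m : ℕ) → (S → Vector S m → Set) → Set
  FormulaDefinable m R = Σ (CForm C (suc m)) λ ψ → (p : S) (τ : Vector S m) → p ∈ᶜ P → AllNames τ →
                         CSat _∈_ _∈ᶜ_ ψ (p ∷ τ) ⇔ R p τ

  private
    variable
      R R' : S → Vector S m → Set

  Definable⇒FormulaDefinable : Definable m R → FormulaDefinable m R
  Definable⇒FormulaDefinable (X , e) =
    proj₁ (expr-TupleIn X) , λ p τ pP nτ → ⇔-sym (e p τ pP nτ) ⇔-∘ proj₂ (expr-TupleIn X) (p ∷ τ)

  FormulaDefinable-⊎ : FormulaDefinable m R → FormulaDefinable m R' →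
                       FormulaDefinable m (λ p τ → R p τ ⊎ R' p τ)
  FormulaDefinable-⊎ (ψ , e) (χ , f) = proj₁ E , λ p τ pP nτ →
    (e p τ pP nτ ⊎-⇔ f p τ pP nτ) ⇔-∘ proj₂ E (p ∷ τ)
    where
    E = expr-⊎ (CSat-expressible ψ) (CSat-expressible χ)

  FormulaDefinable-NoneBelow : FormulaDefinable m R →
                               FormulaDefinable m (λ p τ → NoneBelow p (λ q → R q τ))
  FormulaDefinable-NoneBelow {R = R} (ψ , e) = proj₁ E , λ p τ pP nτ → equiv nτ ⇔-∘ proj₂ E (p ∷ τ)
    where
    ψ' = rename (lift 1 suc) ψ
    E = expr-Π (expr-¬ (expr-× (expr-∈ᶜ zero P)
                               (expr-× (expr-PairIn zero (suc zero) Le) (CSat-expressible ψ'))))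
    equiv : {p : S} {τ : Vector S _} → AllNames τ →
            ((x : S) → ¬ (x ∈ᶜ P × x ≤ p × CSat _∈_ _∈ᶜ_ ψ' (x ∷ p ∷ τ)))
              ⇔ NoneBelow p (λ q → R q τ)
    equiv {p} {τ} nτ = mk⇔
      (λ none (q , qP , q≤p , Rq) → none q (qP , q≤p , from (sat qP) Rq))
      (λ none x (xP , x≤p , c) → none (x , xP , x≤p , to (sat xP) c))
      where
      sat : {x : S} → x ∈ᶜ P → CSat _∈_ _∈ᶜ_ ψ' (x ∷ p ∷ τ) ⇔ R x τ
      sat {x} xP = e x τ xP nτ ⇔-∘ CSat-rename (lift 1 suc) ψ λ { zero → refl ; (suc i) → refl }

  FormulaDefinable-∃name : FormulaDefinable (suc m) R →
                           FormulaDefinable m (λ p τ → Σ S λ σ → IsName σ × R p (σ ∷ τ))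
  FormulaDefinable-∃name {R = R} (ψ , e) = proj₁ E , λ p τ pP nτ → equiv pP nτ ⇔-∘ proj₂ E (p ∷ τ)
    where
    swap : Fin (suc (suc _)) → Fin (suc (suc _))
    swap zero          = suc zero
    swap (suc zero)    = zero
    swap (suc (suc i)) = suc (suc i)
    ψ' = rename swap ψ
    E = expr-Σ (expr-× (expr-IsName zero) (CSat-expressible ψ'))
    equiv : {p : S} {τ : Vector S _} → p ∈ᶜ P → AllNames τ →
            (Σ S λ σ → IsName σ × CSat _∈_ _∈ᶜ_ ψ' (σ ∷ p ∷ τ))
              ⇔ (Σ S λ σ → IsName σ × R p (σ ∷ τ))
    equiv {p} {τ} pP nτ = mk⇔
      (λ (σ , nσ , c) → σ , nσ , to (sat nσ) c)
      (λ (σ , nσ , Rσ) → σ , nσ , from (sat nσ) Rσ)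
      where
      sat : {σ : S} → IsName σ → CSat _∈_ _∈ᶜ_ ψ' (σ ∷ p ∷ τ) ⇔ R p (σ ∷ τ)
      sat {σ} nσ = e p (σ ∷ τ) pP (AllNames-∷ nσ nτ) ⇔-∘
                   CSat-rename swap ψ λ { zero → refl ; (suc zero) → refl ; (suc (suc i)) → refl }

module ForcingLemmas {M : GBCModel} {ℙ : ClassForcingNotion M} {n : ℕ} {Γ : Fin n → ClassName M ℙ}
                     {k : ℕ} {φ : Formula n k} (F : ForcingDefs.ForcingRelation M ℙ Γ φ) where
  open GBCModel M
  open ClassForcingNotion ℙ
  open Names M ℙ
  open Order M ℙ
  open NameVectors M ℙ
  open ForcingDefs M ℙ Γ
  open ForcingRelation F
  open Clauses ⊩∈ ⊩≐ ⊩Γ ⊩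

  private
    variable
      m : ℕ
      p q σ υ : S
      τ : Vector S m
      ψ : Formula n m

  unfold : ψ ≼ φ → p ∈ᶜ P → AllNames τ → ⊩ ψ p τ → Clause ψ p τ
  unfold s pP nτ = to (clause-sub s _ _ pP nτ)

  fold : ψ ≼ φ → p ∈ᶜ P → AllNames τ → Clause ψ p τ → ⊩ ψ p τ
  fold s pP nτ = from (clause-sub s _ _ pP nτ)

  ForcesSub-mono : q ≤ p → ForcesSub p σ υ → ForcesSub q σ υ
  ForcesSub-mono q≤p h ρ s ρs q' q'P q'≤q = h ρ s ρs q' q'P (≤-trans′ q'P q'≤q q≤p)

  ForcesSub-idem : DenselyBelow p (λ q → ForcesSub q σ υ) → ForcesSub p σ υ
  ForcesSub-idem h ρ s ρs q' q'P q'≤p q'≤s =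
    let (q₁ , q₁P , q₁≤q' , sub) = h q' q'P q'≤p
        (q , qP , q≤q₁ , forced) = sub ρ s ρs q₁ q₁P (≤-refl q₁ q₁P) (≤-trans′ q₁P q₁≤q' q'≤s)
    in q , qP , ≤-trans′ qP q≤q₁ q₁≤q' , forced

  ⊩-mono : ψ ≼ φ → p ∈ᶜ P → q ∈ᶜ P → AllNames τ → q ≤ p → ⊩ ψ p τ → ⊩ ψ q τ
  ⊩-mono {ψ = i ∈ᶠ j} s pP qP nτ q≤p f = fold s qP nτ (from (clause-∈ _ _ _ qP (nτ i) (nτ j))
    (DenselyBelow-mono q≤p (to (clause-∈ _ _ _ pP (nτ i) (nτ j)) (unfold s pP nτ f))))
  ⊩-mono {ψ = i ≐ᶠ j} s pP qP nτ q≤p f =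
    let (sub , sup) = to (clause-≐ _ _ _ pP (nτ i) (nτ j)) (unfold s pP nτ f) in
    fold s qP nτ (from (clause-≐ _ _ _ qP (nτ i) (nτ j))
      (ForcesSub-mono q≤p sub , ForcesSub-mono q≤p sup))
  ⊩-mono {ψ = i ∈Γ c} s pP qP nτ q≤p f = fold s qP nτ (from (clause-Γ c _ _ qP (nτ i))
    (DenselyBelow-mono q≤p (to (clause-Γ c _ _ pP (nτ i)) (unfold s pP nτ f))))
  ⊩-mono {ψ = ¬ᶠ ψ} s pP qP nτ q≤p f = fold s qP nτ λ (r , rP , r≤q , forced) →
    unfold s pP nτ f (r , rP , ≤-trans′ rP r≤q q≤p , forced)
  ⊩-mono {ψ = ψ ∧ᶠ χ} s pP qP nτ q≤p f =
    let (fψ , fχ) = unfold s pP nτ f in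
    fold s qP nτ (⊩-mono (≼-∧ˡ⁻ s) pP qP nτ q≤p fψ , ⊩-mono (≼-∧ʳ⁻ s) pP qP nτ q≤p fχ)
  ⊩-mono {ψ = ∀ᶠ ψ} s pP qP nτ q≤p f = fold s qP nτ λ σ nσ →
    ⊩-mono (≼-∀⁻ s) pP qP (AllNames-∷ nσ nτ) q≤p (unfold s pP nτ f σ nσ)

  ⊩-dense : ψ ≼ φ → p ∈ᶜ P → AllNames τ → DenselyBelow p (λ q → ⊩ ψ q τ) → ⊩ ψ p τ
  ⊩-dense {ψ = i ∈ᶠ j} s pP nτ h = fold s pP nτ (from (clause-∈ _ _ _ pP (nτ i) (nτ j))
    (DenselyBelow-idem (DenselyBelow-map
      (λ qP f → to (clause-∈ _ _ _ qP (nτ i) (nτ j)) (unfold s qP nτ f)) h)))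
  ⊩-dense {ψ = i ≐ᶠ j} s pP nτ h = fold s pP nτ (from (clause-≐ _ _ _ pP (nτ i) (nτ j))
    (ForcesSub-idem (DenselyBelow-map (λ qP → proj₁ ∘ clause qP) h) ,
     ForcesSub-idem (DenselyBelow-map (λ qP → proj₂ ∘ clause qP) h)))
    where
    clause : {q : S} → q ∈ᶜ P → ⊩ (i ≐ᶠ j) q _ → ClauseEq q _ _
    clause qP f = to (clause-≐ _ _ _ qP (nτ i) (nτ j)) (unfold s qP nτ f)
  ⊩-dense {ψ = i ∈Γ c} s pP nτ h = fold s pP nτ (from (clause-Γ c _ _ pP (nτ i))
    (DenselyBelow-idem (DenselyBelow-map
      (λ qP f → to (clause-Γ c _ _ qP (nτ i)) (unfold s qP nτ f)) h)))
  ⊩-dense {ψ = ¬ᶠ ψ} s pP nτ h = fold s pP nτ λ (r , rP , r≤p , forced) →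
    let (q , qP , q≤r , f) = h r rP r≤p in
    unfold s qP nτ f (q , qP , ≤-refl q qP , ⊩-mono (≼-¬⁻ s) rP qP nτ q≤r forced)
  ⊩-dense {ψ = ψ ∧ᶠ χ} s pP nτ h = fold s pP nτ
    (⊩-dense (≼-∧ˡ⁻ s) pP nτ (DenselyBelow-map (λ qP → proj₁ ∘ unfold s qP nτ) h) ,
     ⊩-dense (≼-∧ʳ⁻ s) pP nτ (DenselyBelow-map (λ qP → proj₂ ∘ unfold s qP nτ) h))
  ⊩-dense {ψ = ∀ᶠ ψ} s pP nτ h = fold s pP nτ λ σ nσ →
    ⊩-dense (≼-∀⁻ s) pP (AllNames-∷ nσ nτ) (DenselyBelow-map (λ qP f → unfold s qP nτ f σ nσ) h)

  -- If r does not force ∀ψ, then r does not force some instance ψ(σ), which by ⊩-dense is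
  -- therefore refuted below r.
  DenselyBelow-⊩∀-or-NoneBelow-instance :
    DoubleNegationElimination 0ℓ → (∀ᶠ ψ) ≼ φ → AllNames τ →
    DenselyBelow p (λ q → ⊩ (∀ᶠ ψ) q τ ⊎ Σ S λ σ → IsName σ × NoneBelow q (λ q' → ⊩ ψ q' (σ ∷ τ)))
  DenselyBelow-⊩∀-or-NoneBelow-instance dne s nτ r rP _ = dne λ ¬decided →
    ¬decided (r , rP , ≤-refl r rP , inj₁ (fold s rP nτ λ σ nσ → dne λ ¬forced →
      let (q , qP , q≤r , none) = ¬DenselyBelow⇒NoneBelow dne
                                    (¬forced ∘ ⊩-dense (≼-∀⁻ s) rP (AllNames-∷ nσ nτ))
      in ¬decided (q , qP , q≤r , inj₂ (σ , nσ , none))))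

module Truth (em : ExcludedMiddle 0ℓ) {M : GBCModel} {ℙ : ClassForcingNotion M} {n : ℕ}
             {Γ : Fin n → ClassName M ℙ} {k : ℕ} {φ : Formula n k}
             (F : ForcingDefs.ForcingRelation M ℙ Γ φ) (G : GBCModel.S M → Set)
             (G-generic : Names.IsGeneric M ℙ G) where
  open GBCModel M
  open IsGBC isGBC using (comprehension)
  open ClassForcingNotion ℙ
  open Names M ℙ
  open NameVectors M ℙ
  open Order M ℙ
  open FormulaDefinability em M ℙ
  open ForcingDefs M ℙ Γ
  open ForcingRelation F
  open Clauses ⊩∈ ⊩≐ ⊩Γ ⊩ using (Clause)
  open ForcingLemmas F
  open Extension F G

  private
    variable
      m : ℕ
      p q : S
      τ : Vector S m
      ψ : Formula n m

  G⊆P : G p → p ∈ᶜ P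
  G⊆P = proj₁ (proj₁ G-generic) _

  G-directed : G p → G q → Σ S λ r → G r × r ≤ p × r ≤ q
  G-directed = proj₂ (proj₂ (proj₂ (proj₁ G-generic))) _ _

  Forced : Formula n m → Vector S m → Set
  Forced ψ τ = Σ S λ p → G p × ⊩ ψ p τ

  generic-meets : {R : S → Vector S m → Set} → FormulaDefinable m R → AllNames τ →
                  DenselyBelow 𝟙 (λ q → R q τ) → Σ S λ p → G p × R p τ
  generic-meets {τ = τ} (ψ , e) nτ dense with comprehension ((zero ∈ᶜᵥ P) ∧ᵥ ψ) τ
  ... | D , ∈D⇔ with proj₂ G-generic D (D⊆P , D-dense)
    where
    D⊆P : (q : S) → q ∈ᶜ D → q ∈ᶜ P
    D⊆P q q∈D = proj₁ (to (∈D⇔ q) q∈D)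
    D-dense : (p : S) → p ∈ᶜ P → Σ S λ q → q ∈ᶜ D × q ≤ p
    D-dense p pP = let (q , qP , q≤p , Rq) = dense p pP (𝟙-top p pP) in
                   q , from (∈D⇔ q) (qP , from (e q τ qP nτ) Rq) , q≤p
  ... | p , Gp , p∈D = p , Gp , to (e p τ (G⊆P Gp) nτ) (proj₂ (to (∈D⇔ p) p∈D))

  NoneBelow⇒¬Forced : ψ ≼ φ → AllNames τ → G p → NoneBelow p (λ q → ⊩ ψ q τ) → ¬ Forced ψ τ
  NoneBelow⇒¬Forced s nτ Gp none (p' , Gp' , f) =
    let (q , Gq , q≤p , q≤p') = G-directed Gp Gp' in
    none (q , G⊆P Gq , q≤p , ⊩-mono s (G⊆P Gp') (G⊆P Gq) nτ q≤p' f)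

  ClauseInG⇔Forced : ψ ≼ φ → AllNames τ → (Σ S λ p → G p × Clause ψ p τ) ⇔ Forced ψ τ
  ClauseInG⇔Forced s nτ = mk⇔ (λ (p , Gp , c) → p , Gp , fold s (G⊆P Gp) nτ c)
                              (λ (p , Gp , f) → p , Gp , unfold s (G⊆P Gp) nτ f)

  G-decides : ψ ≼ φ → AllNames τ → Σ S λ p → G p × (⊩ ψ p τ ⊎ NoneBelow p (λ q → ⊩ ψ q τ))
  G-decides s nτ =
    generic-meets (FormulaDefinable-⊎ ⊩ψ (FormulaDefinable-NoneBelow ⊩ψ)) nτ (DenselyBelow-decided em)
    where
    ⊩ψ = Definable⇒FormulaDefinable (def-sub s)

  G-decides-∀ : {ψ : Formula n (suc m)} → (∀ᶠ ψ) ≼ φ → AllNames τ →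
    Σ S λ p → G p × (⊩ (∀ᶠ ψ) p τ ⊎ Σ S λ σ → IsName σ × NoneBelow p (λ q → ⊩ ψ q (σ ∷ τ)))
  G-decides-∀ s nτ =
    generic-meets (FormulaDefinable-⊎ ⊩∀ψ (FormulaDefinable-∃name (FormulaDefinable-NoneBelow ⊩ψ))) nτ
                  (DenselyBelow-⊩∀-or-NoneBelow-instance (em⇒dne em) s nτ)
    where
    ⊩∀ψ = Definable⇒FormulaDefinable (def-sub s)
    ⊩ψ  = Definable⇒FormulaDefinable (def-sub (≼-∀⁻ s))

  Sat⇔Forced : ψ ≼ φ → AllNames τ → Sat ψ τ ⇔ Forced ψ τ
  Sat⇔Forced {ψ = _ ∈ᶠ _} = ClauseInG⇔Forced
  Sat⇔Forced {ψ = _ ≐ᶠ _} = ClauseInG⇔Forced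
  Sat⇔Forced {ψ = _ ∈Γ _} = ClauseInG⇔Forced
  Sat⇔Forced {ψ = ¬ᶠ ψ} {τ = τ} s nτ = mk⇔ sat⇒forced forced⇒sat
    where
    ih : Sat ψ τ ⇔ Forced ψ τ
    ih = Sat⇔Forced (≼-¬⁻ s) nτ
    forced⇒sat : Forced (¬ᶠ ψ) τ → ¬ Sat ψ τ
    forced⇒sat (p , Gp , f) = NoneBelow⇒¬Forced (≼-¬⁻ s) nτ Gp (unfold s (G⊆P Gp) nτ f) ∘ to ih
    sat⇒forced : ¬ Sat ψ τ → Forced (¬ᶠ ψ) τ
    sat⇒forced ¬sat = let (p , Gp , decided) = G-decides (≼-¬⁻ s) nτ in
      [ (λ f → ⊥-elim (¬sat (from ih (p , Gp , f))))
      , (λ none → p , Gp , fold s (G⊆P Gp) nτ none) ]′ decided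
  Sat⇔Forced {ψ = ψ ∧ᶠ χ} {τ = τ} s nτ = mk⇔ sat⇒forced forced⇒sat
    where
    ihψ = Sat⇔Forced (≼-∧ˡ⁻ s) nτ
    ihχ = Sat⇔Forced (≼-∧ʳ⁻ s) nτ
    sat⇒forced : Sat (ψ ∧ᶠ χ) τ → Forced (ψ ∧ᶠ χ) τ
    sat⇒forced (satψ , satχ) =
      let (p , Gp , fψ)  = to ihψ satψ
          (p' , Gp' , fχ) = to ihχ satχ
          (q , Gq , q≤p , q≤p') = G-directed Gp Gp'
      in q , Gq , fold s (G⊆P Gq) nτ (⊩-mono (≼-∧ˡ⁻ s) (G⊆P Gp) (G⊆P Gq) nτ q≤p fψ ,
                                       ⊩-mono (≼-∧ʳ⁻ s) (G⊆P Gp') (G⊆P Gq) nτ q≤p' fχ)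
    forced⇒sat : Forced (ψ ∧ᶠ χ) τ → Sat (ψ ∧ᶠ χ) τ
    forced⇒sat (p , Gp , f) = let (fψ , fχ) = unfold s (G⊆P Gp) nτ f in
                              from ihψ (p , Gp , fψ) , from ihχ (p , Gp , fχ)
  Sat⇔Forced {ψ = ∀ᶠ ψ} {τ = τ} s nτ = mk⇔ sat⇒forced forced⇒sat
    where
    ih : {σ : S} → IsName σ → Sat ψ (σ ∷ τ) ⇔ Forced ψ (σ ∷ τ)
    ih nσ = Sat⇔Forced (≼-∀⁻ s) (AllNames-∷ nσ nτ)
    forced⇒sat : Forced (∀ᶠ ψ) τ → Sat (∀ᶠ ψ) τ
    forced⇒sat (p , Gp , f) σ nσ = from (ih nσ) (p , Gp , unfold s (G⊆P Gp) nτ f σ nσ)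
    sat⇒forced : Sat (∀ᶠ ψ) τ → Forced (∀ᶠ ψ) τ
    sat⇒forced sat = let (p , Gp , decided) = G-decides-∀ s nτ in
      [ (λ f → p , Gp , f)
      , (λ (σ , nσ , none) → ⊥-elim
           (NoneBelow⇒¬Forced (≼-∀⁻ s) (AllNames-∷ nσ nτ) Gp none (to (ih nσ) (sat σ nσ)))) ]′ decided

theorem7 : ExcludedMiddle 0ℓ →
    (M : GBCModel) (ℙ : ClassForcingNotion M) (n k : ℕ)
    (Γ : Fin (suc n) → ClassName M ℙ) (φ : Formula (suc n) k)
    (F : ForcingDefs.ForcingRelation M ℙ Γ φ)
    (G : GBCModel.S M → Set) → Names.IsGeneric M ℙ G →
    (τ : Vector (GBCModel.S M) k) → Names.AllNames M ℙ τ →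
    ForcingDefs.Extension.Sat M ℙ Γ F G φ τ
      ⇔ (Σ (GBCModel.S M) λ p → G p × ForcingDefs.ForcingRelation.⊩ F φ p τ)
theorem7 em M ℙ n k Γ φ F G G-generic τ nτ = Truth.Sat⇔Forced em F G G-generic ≼-refl nτ
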